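{- Let $n\ge 2$ and let $k_1,\dots,k_n\ge 3$ be integers. Let $\mathcal{H}_{\{k_1-1,\dots,k_n-1\}}$ be the hinge graph obtained by gluing cycles $C_1,\dots,C_n$ with $k_1,\dots,k_n$ vertices along one common edge $xy$. Fix $i$, and let $\epsilon_{x,y}$ be the divisor that assigns $1$ and $-1$ to a shared vertex and to a non-shared vertex of $C_i$ adjacent to it (in either order), and $0$ elsewhere. Let $\delta_{x,y}$ be the divisor assigning $1$ to one shared vertex, $-1$ to the other, and $0$ elsewhere. Suppose that either there are at least two base cycles with $k_i$ vertices, or there exists another base cycle $C_j$ ($j\ne i$) with $t(k_i-1)+1$ vertices for some positive integer $t$. Then the order of $\epsilon_{x,y}$ in the critical group is $(k_i-1)|\delta_{x,y}|$, where $|\delta_{x,y}|$ denotes the order of $\delta_{x,y}$.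
   Context: The hinge graph $\mathcal{H}_{\{k_1-1,\dots,k_n-1\}}$ is the simple graph with two distinguished ("shared") vertices $x,y$ joined by an edge $xy$, together with $n$ internally vertex-disjoint paths from $x$ to $y$, the $i$-th path having $k_i-2$ internal vertices; the $i$-th path together with $xy$ is the cycle $C_i$ (base shape) with $k_i$ vertices. A divisor is a formal $\mathbb{Z}$-linear combination of vertices; two divisors are linearly equivalent if their difference lies in the image of the graph Laplacian (equivalently, one is obtained from the other by chip-firing moves). The order of a degree-zero divisor $D$ is the smallest positive integer $z$ such that $zD$ is linearly equivalent to the zero divisor. -}

module Defs where

open import Data.Nat as ℕ using (ℕ; zero; suc; _∸_; _≡ᵇ_)
open import Data.Fin using (Fin; toℕ; zero)
open import Data.Fin.Base using () renaming (suc to fsuc)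
open import Data.List using (List; _∷_; []; map; concatMap; foldr)
open import Data.List.Base using (allFin)
open import Data.Bool using (Bool; true; false; _∧_; _∨_; if_then_else_)
open import Data.Integer as ℤ using (ℤ; +_; 0ℤ; 1ℤ; -1ℤ)
open import Data.Product using (Σ; ∃; _×_; _,_)
open import Data.Sum using (_⊎_)
open import Relation.Binary.PropositionalEquality using (_≡_)
open import Relation.Nullary using (¬_)

-- Vertices of the hinge graph H_{k_1-1,...,k_n-1}:
-- the two shared vertices x, y and, for each path i, its k i - 2 internal
-- vertices.  internal i j (j = 0 .. k i - 3) is the vertex p_(j+1) on the
-- path x = p_0 , p_1 , ... , p_(k i - 2) , p_(k i - 1) = y.
data V (n : ℕ) (k : Fin n → ℕ) : Set where
  vx vy    : V n k
  internal : (i : Fin n) → Fin (k i ∸ 2) → V n k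

module _ {n : ℕ} {k : Fin n → ℕ} where

  eqV : V n k → V n k → Bool
  eqV vx vx = true
  eqV vy vy = true
  eqV (internal i j) (internal i' j') = (toℕ i ≡ᵇ toℕ i') ∧ (toℕ j ≡ᵇ toℕ j')
  eqV _ _ = false

  edge : V n k → V n k → Bool
  edge vx vy = true
  edge vx (internal i j) = toℕ j ≡ᵇ 0
  edge (internal i j) vy = suc (toℕ j) ≡ᵇ (k i ∸ 2)
  edge (internal i j) (internal i' j') = (toℕ i ≡ᵇ toℕ i') ∧ (suc (toℕ j) ≡ᵇ toℕ j')
  edge _ _ = false

  adj : V n k → V n k → Bool
  adj v w = edge v w ∨ edge w v

  vertices : List (V n k)
  vertices = vx ∷ vy ∷ concatMap (λ i → map (internal i) (allFin (k i ∸ 2))) (allFin n)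

  Divisor : Set
  Divisor = V n k → ℤ

  sumℤ : List ℤ → ℤ
  sumℤ = foldr ℤ._+_ 0ℤ

  laplacian : (V n k → ℤ) → Divisor
  laplacian f v = sumℤ (map (λ w → if adj v w then f v ℤ.- f w else 0ℤ) vertices)

  Principal : Divisor → Set
  Principal D = Σ (V n k → ℤ) λ f → ∀ v → D v ≡ laplacian f v

  _∼_ : Divisor → Divisor → Set
  D ∼ D' = Principal (λ v → D v ℤ.- D' v)

  zeroDiv : Divisor
  zeroDiv _ = 0ℤ

  degree : Divisor → ℤ
  degree D = sumℤ (map D vertices)

  _·_ : ℕ → Divisor → Divisor
  (z · D) v = + z ℤ.* D v

  IsOrder : Divisor → ℕ → Set
  IsOrder D z = (0 ℕ.< z) × ((z · D) ∼ zeroDiv)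
              × (∀ w → 0 ℕ.< w → w ℕ.< z → ¬ ((w · D) ∼ zeroDiv))

  unitDiff : V n k → V n k → Divisor
  unitDiff a b v = (if eqV v a then 1ℤ else 0ℤ) ℤ.- (if eqV v b then 1ℤ else 0ℤ)

  δxy : Divisor
  δxy = unitDiff vx vy

  IsShared : V n k → Set
  IsShared v = (v ≡ vx) ⊎ (v ≡ vy)

  InternalOf : Fin n → V n k → Set
  InternalOf i v = ∃ λ j → v ≡ internal i j

{-# OPTIONS --safe #-}
-- The Laplacian of a firing f vanishes at the internal vertices of a path exactly when f is
-- affine along it.  Hence w·δ ∼ 0 iff there are integers d = f x − f y and c j (the drop of f
-- on the first edge of path j) with d = (k j − 1) c j for every j and w = d + Σ c j, the
-- Laplacian at x; for ε the source at the first internal vertex of path i turns the i-th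
-- equation into d = (k i − 1) c i − (k i − 2) w.  With ℓ = lcm (k j − 1) the δ-solutions are
-- exactly the multiples of m = ℓ + Σ ℓ / (k j − 1), because ℓ w = d m and ℓ ∣ d.  The
-- hypothesis on the base cycles gives k i − 1 ∣ k j₀ − 1 for some j₀ ≠ i, hence k i − 1 ∣ d,
-- and then the i-th equation forces w = (k i − 1) w′ with w′ a δ-solution, and conversely.
-- The other adjacent pairs give ±ε up to linear equivalence: firing the internal vertices of
-- path i turns χ x − χ (first vertex) into χ (last vertex) − χ y.
module Submission where

open import Defs
import Algebra.Properties.Semiring.Sum as SemiringSum
open import Data.Bool using (Bool; true; false; T; _∧_; _∨_; if_then_else_)
open import Data.Bool.Properties using (if-eta; ∧-zeroʳ; ∨-identityʳ)
open import Data.Empty using (⊥-elim)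
open import Data.Fin using (Fin; toℕ; fromℕ<; zero) renaming (suc to fsuc)
open import Data.Fin.Properties using (toℕ-injective; toℕ-fromℕ<; toℕ<n; suc-injective)
open import Data.Integer using (ℤ; +_; 0ℤ; 1ℤ; -1ℤ; ∣_∣)
import Data.Integer.Properties as ℤP
open import Data.Integer.Tactic.RingSolver using (solve-∀)
open import Data.List using (List; []; _∷_; _++_; map; concatMap; foldr; tabulate; allFin)
open import Data.List.Properties using (map-++; map-∘)
open import Data.Nat as ℕ using (ℕ; zero; suc; _∸_; _≡ᵇ_; _≤_; _<_; s≤s; z≤n; NonZero)
import Data.Nat.Properties as ℕP
open import Data.Nat.Divisibility
  using (_∣_; divides; 1∣_; ∣-reflexive; ∣-trans; ∣⇒≤; 0∣⇒≡0; m∣m*n; n∣m*n; *-monoˡ-∣; *-monoʳ-∣; *-cancelˡ-∣)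
open import Data.Nat.LCM using (lcm; m∣lcm[m,n]; n∣lcm[m,n]; lcm-least)
open import Data.Product using (Σ; _×_; _,_; proj₁; proj₂)
open import Data.Sum using (_⊎_; inj₁; inj₂)
open import Function using (_∘_; id; _⇔_; mk⇔; Equivalence)
open import Relation.Binary.PropositionalEquality

≡ᵇ-refl : ∀ m → (m ≡ᵇ m) ≡ true
≡ᵇ-refl zero = refl
≡ᵇ-refl (suc m) = ≡ᵇ-refl m

≡ᵇ-sym : ∀ m n → (m ≡ᵇ n) ≡ (n ≡ᵇ m)
≡ᵇ-sym zero zero = refl
≡ᵇ-sym zero (suc n) = refl
≡ᵇ-sym (suc m) zero = refl
≡ᵇ-sym (suc m) (suc n) = ≡ᵇ-sym m n

≡ᵇ-true⇒≡ : ∀ m n → (m ≡ᵇ n) ≡ true → m ≡ n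
≡ᵇ-true⇒≡ m n eq = ℕP.≡ᵇ⇒≡ m n (subst T (sym eq) _)

_≡ᶠ_ : ∀ {n} → Fin n → Fin n → Bool
i ≡ᶠ j = toℕ i ≡ᵇ toℕ j

≡ᶠ-true⇒≡ : ∀ {n} {i j : Fin n} → (i ≡ᶠ j) ≡ true → i ≡ j
≡ᶠ-true⇒≡ eq = toℕ-injective (≡ᵇ-true⇒≡ _ _ eq)

≢⇒≡ᶠ-false : ∀ {n} {i j : Fin n} → i ≢ j → (i ≡ᶠ j) ≡ false
≢⇒≡ᶠ-false {i = i} {j} i≢j with i ≡ᶠ j in eq
... | false = refl
... | true = ⊥-elim (i≢j (≡ᶠ-true⇒≡ eq))

≡ᶠ-false⇒≢ : ∀ {n} {i j : Fin n} → (i ≡ᶠ j) ≡ false → i ≢ j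
≡ᶠ-false⇒≢ {i = i} eq refl with () ← trans (sym (≡ᵇ-refl (toℕ i))) eq

suc-∸1 : ∀ {m} → 1 ≤ m → suc (m ∸ 1) ≡ m
suc-∸1 {suc m} _ = refl

3≤⇒1≤∸2 : ∀ {m} → 3 ≤ m → 1 ≤ m ∸ 2
3≤⇒1≤∸2 (s≤s (s≤s (s≤s _))) = s≤s z≤n

∸1≡suc∸2 : ∀ m → 1 ≤ m ∸ 2 → m ∸ 1 ≡ suc (m ∸ 2)
∸1≡suc∸2 (suc (suc (suc m))) _ = refl

1≤⇒≡ᵇ0-false : ∀ {m} → 1 ≤ m → (m ≡ᵇ 0) ≡ false
1≤⇒≡ᵇ0-false {suc m} _ = refl

<⇒≡ᵇ-false : ∀ {m n} → m < n → (m ≡ᵇ n) ≡ false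
<⇒≡ᵇ-false {zero} {suc n} _ = refl
<⇒≡ᵇ-false {suc m} {suc n} (s≤s m<n) = <⇒≡ᵇ-false m<n

suc≡ᵇ-cong : ∀ a {b m} → suc b ≡ m → (suc a ≡ᵇ m) ≡ (a ≡ᵇ b)
suc≡ᵇ-cong a refl = refl

module ℤΣ = SemiringSum ℤP.+-*-semiring
module ℕΣ = SemiringSum ℕP.+-*-semiring
open ℤΣ using (sum; sum-cong-≗; *-distribˡ-sum; *-distribʳ-sum)

module _ where
  open import Data.Integer using (_+_; _-_; _*_; -_)

  sum-zero : ∀ {m} {F : Fin m → ℤ} → (∀ s → F s ≡ 0ℤ) → sum F ≡ 0ℤ
  sum-zero {m} F≡0 = trans (sum-cong-≗ F≡0) (ℤΣ.sum-replicate-zero m)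

  sum-single : ∀ {m} (F : Fin m → ℤ) j → (∀ j′ → j′ ≢ j → F j′ ≡ 0ℤ) → sum F ≡ F j
  sum-single F zero off =
    trans (cong (_+_ (F zero)) (sum-zero (λ s → off (fsuc s) λ ()))) (ℤP.+-identityʳ _)
  sum-single F (fsuc j) off =
    trans (cong (_+ sum (F ∘ fsuc)) (off zero λ ()))
      (trans (ℤP.+-identityˡ _)
        (sum-single (F ∘ fsuc) j λ j′ j′≢j → off (fsuc j′) (j′≢j ∘ suc-injective)))

  sum-indicator : ∀ {m} (i : Fin m) a → sum (λ j → if j ≡ᶠ i then a else 0ℤ) ≡ a
  sum-indicator {suc m} zero a = trans (cong (_+_ a) (sum-zero {m} λ _ → refl)) (ℤP.+-identityʳ a)
  sum-indicator {suc m} (fsuc i) a = trans (ℤP.+-identityˡ _) (sum-indicator i a)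

  sum-update : ∀ {m} (e : Fin m → ℤ) i A → sum (λ j → if j ≡ᶠ i then e j + A else e j) ≡ sum e + A
  sum-update {suc m} e zero A = lemma (e zero) (sum (e ∘ fsuc)) A
    where lemma : ∀ a S A → (a + A) + S ≡ (a + S) + A
          lemma = solve-∀
  sum-update {suc m} e (fsuc i) A =
    trans (cong (_+_ (e zero)) (sum-update (e ∘ fsuc) i A)) (sym (ℤP.+-assoc (e zero) _ _))

  sum-neg : ∀ {m} (F : Fin m → ℤ) → sum (λ j → - F j) ≡ - sum F
  sum-neg {zero} F = refl
  sum-neg {suc m} F =
    trans (cong (_+_ (- F zero)) (sum-neg (F ∘ fsuc))) (sym (ℤP.neg-distrib-+ (F zero) _))

  sum-pos : ∀ {m} (F : Fin m → ℕ) → sum (λ j → + F j) ≡ + ℕΣ.sum F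
  sum-pos {zero} F = refl
  sum-pos {suc m} F = trans (cong (_+_ (+ F zero)) (sum-pos (F ∘ fsuc))) (sym (ℤP.pos-+ (F zero) _))

  neg-indicator : ∀ b W → W * (0ℤ - (if b then 1ℤ else 0ℤ)) ≡ (if b then - W else 0ℤ)
  neg-indicator true W = trans (ℤP.*-comm W -1ℤ) (ℤP.-1*i≡-i W)
  neg-indicator false W = ℤP.*-zeroʳ W

  -- Defs.sumℤ without its graph parameters.
  listSum : List ℤ → ℤ
  listSum = foldr _+_ 0ℤ

  listSum-++ : ∀ xs ys → listSum (xs ++ ys) ≡ listSum xs + listSum ys
  listSum-++ [] ys = sym (ℤP.+-identityˡ _)
  listSum-++ (x ∷ xs) ys = trans (cong (_+_ x) (listSum-++ xs ys)) (sym (ℤP.+-assoc x _ _))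

  listSum-concatMap : ∀ {A B : Set} (F : B → ℤ) (blocks : A → List B) xs →
    listSum (map F (concatMap blocks xs)) ≡ listSum (map (listSum ∘ map F ∘ blocks) xs)
  listSum-concatMap F blocks [] = refl
  listSum-concatMap F blocks (x ∷ xs) = begin
      listSum (map F (blocks x ++ concatMap blocks xs))
    ≡⟨ cong listSum (map-++ F (blocks x) _) ⟩
      listSum (map F (blocks x) ++ map F (concatMap blocks xs))
    ≡⟨ listSum-++ (map F (blocks x)) _ ⟩
      listSum (map F (blocks x)) + listSum (map F (concatMap blocks xs))
    ≡⟨ cong (_+_ (listSum (map F (blocks x)))) (listSum-concatMap F blocks xs) ⟩
      listSum (map (listSum ∘ map F ∘ blocks) (x ∷ xs)) ∎
    where open ≡-Reasoning

  listSum-tabulate : ∀ {A : Set} {m} (g : Fin m → A) (F : A → ℤ) →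
    listSum (map F (tabulate g)) ≡ sum (F ∘ g)
  listSum-tabulate {m = zero} g F = refl
  listSum-tabulate {m = suc m} g F = cong (_+_ (F (g zero))) (listSum-tabulate (g ∘ fsuc) F)

  listSum-lincomb : ∀ {A : Set} (p : A → Bool) a b (F G H : A → ℤ) → (∀ x → F x ≡ a * G x + b * H x) →
    ∀ xs → listSum (map (λ x → if p x then F x else 0ℤ) xs)
         ≡ a * listSum (map (λ x → if p x then G x else 0ℤ) xs)
           + b * listSum (map (λ x → if p x then H x else 0ℤ) xs)
  listSum-lincomb p a b F G H F≡ [] = sym (cong₂ _+_ (ℤP.*-zeroʳ a) (ℤP.*-zeroʳ b))
  listSum-lincomb p a b F G H F≡ (x ∷ xs) with p x
  ... | true rewrite F≡ x | listSum-lincomb p a b F G H F≡ xs = lemma a b (G x) (H x) _ _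
    where lemma : ∀ a b g h S T → (a * g + b * h) + (a * S + b * T) ≡ a * (g + S) + b * (h + T)
          lemma = solve-∀
  ... | false rewrite listSum-lincomb p a b F G H F≡ xs = lemma a b _ _
    where lemma : ∀ a b S T → 0ℤ + (a * S + b * T) ≡ a * (0ℤ + S) + b * (0ℤ + T)
          lemma = solve-∀

  -- profile m h X Y lists the path X, h 0, …, h (m ∸ 1), Y by position 0, 1, …, m + 1.
  profile : (m : ℕ) → (Fin m → ℤ) → ℤ → ℤ → ℕ → ℤ
  profile m h X Y zero = X
  profile zero h X Y (suc t) = Y
  profile (suc m) h X Y (suc t) = profile m (h ∘ fsuc) (h zero) Y t

  profile-inner : ∀ {m} (h : Fin m → ℤ) X Y (s : Fin m) → profile m h X Y (suc (toℕ s)) ≡ h s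
  profile-inner h X Y zero = refl
  profile-inner h X Y (fsuc s) = profile-inner (h ∘ fsuc) (h zero) Y s

  profile-last : ∀ m (h : Fin m → ℤ) X Y → profile m h X Y (suc m) ≡ Y
  profile-last zero h X Y = refl
  profile-last (suc m) h X Y = profile-last m (h ∘ fsuc) (h zero) Y

  drop : (ℕ → ℤ) → ℕ → ℤ
  drop g t = g t - g (suc t)

  Δ² : (ℕ → ℤ) → ℕ → ℤ
  Δ² g t = (g (suc t) - g t) + (g (suc t) - g (suc (suc t)))

  Δ²≡drop-difference : ∀ g t → Δ² g t ≡ drop g (suc t) - drop g t
  Δ²≡drop-difference g t = lemma (g t) (g (suc t)) (g (suc (suc t)))
    where lemma : ∀ a b c → (b - a) + (b - c) ≡ (b - c) - (a - b)
          lemma = solve-∀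

  harmonic⇒affine : ∀ (g : ℕ → ℤ) m → (∀ t → suc t < m → Δ² g t ≡ 0ℤ) →
    g 0 - g m ≡ + m * drop g 0
  harmonic⇒affine g zero _ = lemma (g 0) (g 1)
    where lemma : ∀ a b → a - a ≡ 0ℤ * (a - b)
          lemma = solve-∀
  harmonic⇒affine g (suc zero) _ = lemma (g 0) (g 1)
    where lemma : ∀ a b → a - b ≡ 1ℤ * (a - b)
          lemma = solve-∀
  harmonic⇒affine g (suc (suc m)) harmonic = begin
      g 0 - g (2 ℕ.+ m)
    ≡⟨ lemma₁ (g 0) (g 1) (g (2 ℕ.+ m)) ⟩
      drop g 0 + (g 1 - g (2 ℕ.+ m))
    ≡⟨ cong (_+_ (drop g 0)) (harmonic⇒affine (g ∘ suc) (suc m) λ t → harmonic (suc t) ∘ s≤s) ⟩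
      drop g 0 + + suc m * drop g 1
    ≡⟨ cong (λ x → drop g 0 + + suc m * x) equal-drops ⟩
      drop g 0 + + suc m * drop g 0
    ≡⟨ lemma₂ (drop g 0) (+ suc m) ⟩
      (1ℤ + + suc m) * drop g 0
    ≡⟨ cong (_* drop g 0) (sym (ℤP.pos-+ 1 (suc m))) ⟩
      + (2 ℕ.+ m) * drop g 0 ∎
    where
    open ≡-Reasoning
    equal-drops : drop g 1 ≡ drop g 0
    equal-drops =
      ℤP.i-j≡0⇒i≡j _ _ (trans (sym (Δ²≡drop-difference g 0)) (harmonic 0 (s≤s (s≤s z≤n))))
    lemma₁ : ∀ a b c → a - c ≡ (a - b) + (b - c)
    lemma₁ = solve-∀
    lemma₂ : ∀ d M → d + M * d ≡ (1ℤ + M) * d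
    lemma₂ = solve-∀

  first-neighbour-sum : ∀ {m} (h : Fin m → ℤ) X Y → 1 ≤ m →
    sum (λ s → if (toℕ s ≡ᵇ 0) ∨ false then X - h s else 0ℤ) ≡ X - profile m h X Y 1
  first-neighbour-sum {suc m} h X Y _ =
    trans (cong (_+_ (X - h zero)) (sum-zero {m} λ _ → refl)) (ℤP.+-identityʳ _)

  last-neighbour-sum : ∀ {m} (h : Fin m → ℤ) X Y → 1 ≤ m →
    sum (λ s → if suc (toℕ s) ≡ᵇ m then Y - h s else 0ℤ) ≡ Y - profile m h X Y m
  last-neighbour-sum {suc zero} h X Y _ = ℤP.+-identityʳ _
  last-neighbour-sum {suc (suc m)} h X Y _ =
    trans (ℤP.+-identityˡ _) (last-neighbour-sum (h ∘ fsuc) (h zero) Y (s≤s z≤n))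

  -- The Laplacian at an internal vertex restricted to its own path, in the shape adj produces.
  inner-neighbour-sum : ∀ {m} (h : Fin m → ℤ) X Y (s : Fin m) →
    (if toℕ s ≡ᵇ 0 then h s - X else 0ℤ) +
     ((if (suc (toℕ s) ≡ᵇ m) ∨ false then h s - Y else 0ℤ) +
      sum (λ s′ → if (suc (toℕ s) ≡ᵇ toℕ s′) ∨ (suc (toℕ s′) ≡ᵇ toℕ s) then h s - h s′ else 0ℤ))
    ≡ (h s - profile m h X Y (toℕ s)) + (h s - profile m h X Y (suc (suc (toℕ s))))
  inner-neighbour-sum {suc zero} h X Y zero = cong (_+_ (h zero - X)) (ℤP.+-identityʳ _)
  inner-neighbour-sum {suc (suc m)} h X Y zero =
    cong (_+_ (h zero - X)) (trans (ℤP.+-identityˡ _) (trans (ℤP.+-identityˡ _)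
      (first-neighbour-sum (h ∘ fsuc) (h zero) Y (s≤s z≤n))))
  inner-neighbour-sum {suc m} h X Y (fsuc s) rewrite ≡ᵇ-sym 0 (toℕ s) =
    trans (ℤP.+-identityˡ _)
      (trans (swap-front from-previous to-Y _) (inner-neighbour-sum (h ∘ fsuc) (h zero) Y s))
    where
    from-previous to-Y : ℤ
    from-previous = if toℕ s ≡ᵇ 0 then h (fsuc s) - h zero else 0ℤ
    to-Y = if (suc (toℕ s) ≡ᵇ m) ∨ false then h (fsuc s) - Y else 0ℤ
    swap-front : ∀ a b c → b + (a + c) ≡ a + (b + c)
    swap-front = solve-∀

lcmᶠ : ∀ {m} → (Fin m → ℕ) → ℕ
lcmᶠ {zero} F = 1
lcmᶠ {suc m} F = lcm (F zero) (lcmᶠ (F ∘ fsuc))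

∣lcmᶠ : ∀ {m} (F : Fin m → ℕ) j → F j ∣ lcmᶠ F
∣lcmᶠ F zero = m∣lcm[m,n] _ _
∣lcmᶠ F (fsuc j) = ∣-trans (∣lcmᶠ (F ∘ fsuc) j) (n∣lcm[m,n] (F zero) _)

lcmᶠ-least : ∀ {m} (F : Fin m → ℕ) {c} → (∀ j → F j ∣ c) → lcmᶠ F ∣ c
lcmᶠ-least {zero} F {c} _ = 1∣ c
lcmᶠ-least {suc m} F F∣c = lcm-least (F∣c zero) (lcmᶠ-least (F ∘ fsuc) (F∣c ∘ fsuc))

lcm-nonZero : ∀ a b .{{_ : NonZero a}} .{{_ : NonZero b}} → NonZero (lcm a b)
lcm-nonZero a b = ℕ.≢-nonZero λ lcm≡0 →
  ℕ.≢-nonZero⁻¹ (a ℕ.* b) {{ℕP.m*n≢0 a b}}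
    (0∣⇒≡0 (subst (λ x → x ∣ a ℕ.* b) lcm≡0 (lcm-least (m∣m*n {a} b) (n∣m*n a))))

lcmᶠ-nonZero : ∀ {m} (F : Fin m → ℕ) → (∀ j → NonZero (F j)) → NonZero (lcmᶠ F)
lcmᶠ-nonZero {zero} F _ = _
lcmᶠ-nonZero {suc m} F F≢0 =
  lcm-nonZero (F zero) (lcmᶠ (F ∘ fsuc)) {{F≢0 zero}} {{lcmᶠ-nonZero (F ∘ fsuc) (F≢0 ∘ fsuc)}}

module _ {n : ℕ} {k : Fin n → ℕ} where
  open import Data.Integer using (_+_; _-_; _*_; -_)

  laplacian-lincomb : ∀ a b (f g : V n k → ℤ) u →
    laplacian (λ v → a * f v + b * g v) u ≡ a * laplacian f u + b * laplacian g u
  laplacian-lincomb a b f g u =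
    listSum-lincomb (adj u) a b _ _ _ (λ v → lemma a b (f u) (f v) (g u) (g v)) vertices
    where
    lemma : ∀ a b fu fv gu gv → (a * fu + b * gu) - (a * fv + b * gv) ≡ a * (fu - fv) + b * (gu - gv)
    lemma = solve-∀

  principal-lincomb : ∀ a b {D D′ : Divisor {n} {k}} → Principal D → Principal D′ →
    Principal (λ v → a * D v + b * D′ v)
  principal-lincomb a b (f , D≡Δf) (g , D′≡Δg) =
    (λ v → a * f v + b * g v) ,
    λ u → trans (cong₂ (λ x y → a * x + b * y) (D≡Δf u) (D′≡Δg u)) (sym (laplacian-lincomb a b f g u))

  principal-cong : ∀ {D D′ : Divisor {n} {k}} → (∀ v → D v ≡ D′ v) → Principal D → Principal D′
  principal-cong D≡D′ (f , D≡Δf) = f , λ v → trans (sym (D≡D′ v)) (D≡Δf v)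

  ∼-sym : ∀ {D D′ : Divisor {n} {k}} → D ∼ D′ → D′ ∼ D
  ∼-sym {D} {D′} D∼D′ = principal-cong (λ v → lemma (D v) (D′ v)) (principal-lincomb -1ℤ 0ℤ D∼D′ D∼D′)
    where lemma : ∀ x y → -1ℤ * (x - y) + 0ℤ * (x - y) ≡ y - x
          lemma = solve-∀

  annihilated-∼ : ∀ w {D D′ : Divisor {n} {k}} → D ∼ D′ →
    (w · D) ∼ zeroDiv → (w · D′) ∼ zeroDiv
  annihilated-∼ w {D} {D′} D∼D′ wD∼0 =
    principal-cong (λ v → lemma (+ w) (D v) (D′ v)) (principal-lincomb 1ℤ (- + w) wD∼0 D∼D′)
    where lemma : ∀ W x y → 1ℤ * (W * x - 0ℤ) + (- W) * (x - y) ≡ W * y - 0ℤ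
          lemma = solve-∀

  annihilated-neg : ∀ w {D D′ : Divisor {n} {k}} → (∀ v → D′ v ≡ - D v) →
    (w · D) ∼ zeroDiv → (w · D′) ∼ zeroDiv
  annihilated-neg w {D} {D′} D′≡-D wD∼0 =
    principal-cong (λ v → trans (lemma (+ w) (D v)) (cong (λ x → + w * x - 0ℤ) (sym (D′≡-D v))))
      (principal-lincomb -1ℤ 0ℤ wD∼0 wD∼0)
    where lemma : ∀ W x → -1ℤ * (W * x - 0ℤ) + 0ℤ * (W * x - 0ℤ) ≡ W * (- x) - 0ℤ
          lemma = solve-∀

  sum-vertices : (F : V n k → ℤ) →
    listSum (map F vertices) ≡ F vx + (F vy + sum (λ j → sum (F ∘ internal j)))
  sum-vertices F = cong (λ x → F vx + (F vy + x)) (begin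
      listSum (map F (concatMap (λ j → map (internal j) (allFin (k j ∸ 2))) (allFin n)))
    ≡⟨ listSum-concatMap F _ (allFin n) ⟩
      listSum (map (λ j → listSum (map F (map (internal j) (allFin (k j ∸ 2))))) (allFin n))
    ≡⟨ listSum-tabulate id (λ j → listSum (map F (map (internal j) (allFin (k j ∸ 2))))) ⟩
      sum (λ j → listSum (map F (map (internal j) (allFin (k j ∸ 2)))))
    ≡⟨ sum-cong-≗ (λ j → trans (cong listSum (sym (map-∘ (allFin (k j ∸ 2)))))
                                (listSum-tabulate id (F ∘ internal j))) ⟩
      sum (λ j → sum (F ∘ internal j)) ∎)
    where open ≡-Reasoning

  towards : (V n k → ℤ) → V n k → V n k → ℤ
  towards f u v = if adj u v then f u - f v else 0ℤ

  laplacian-split : ∀ f u → laplacian f u ≡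
    towards f u vx + (towards f u vy + sum (λ j → sum (towards f u ∘ internal j)))
  laplacian-split f u = sum-vertices (towards f u)

  unitDiff-swap : ∀ (a b : V n k) v → unitDiff b a v ≡ - unitDiff a b v
  unitDiff-swap a b v = lemma (if eqV v a then 1ℤ else 0ℤ) (if eqV v b then 1ℤ else 0ℤ)
    where lemma : ∀ p q → q - p ≡ - (p - q)
          lemma = solve-∀

  scaled-value : ∀ w (D : Divisor {n} {k}) v → (w · D) v - zeroDiv v ≡ + w * D v
  scaled-value w D v = ℤP.+-identityʳ _

  IsOrder-from-annihilator : ∀ {D : Divisor {n} {k}} m → 0 < m → (m · D) ∼ zeroDiv →
    (∀ w → (w · D) ∼ zeroDiv → m ∣ w) → IsOrder D m
  IsOrder-from-annihilator m 0<m mD∼0 m∣ =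
    0<m , mD∼0 , λ w 0<w w<m wD∼0 → ℕP.<⇒≱ w<m (∣⇒≤ {{ℕ.>-nonZero 0<w}} (m∣ w wD∼0))

-- The Laplacian along the paths of the hinge graph

module Hinge {n : ℕ} {k : Fin n → ℕ} (inner≥1 : ∀ j → 1 ≤ k j ∸ 2) where
  open import Data.Integer using (_+_; _-_; _*_; -_)

  inner len : Fin n → ℕ
  inner j = k j ∸ 2
  len j = k j ∸ 1

  len≡suc-inner : ∀ j → len j ≡ suc (inner j)
  len≡suc-inner j = ∸1≡suc∸2 (k j) (inner≥1 j)

  +len≡1++inner : ∀ j → + len j ≡ 1ℤ + + inner j
  +len≡1++inner j = cong +_ (len≡suc-inner j)

  first : ∀ j → Fin (inner j)
  first j = fromℕ< (inner≥1 j)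

  toℕ-first : ∀ j → toℕ (first j) ≡ 0
  toℕ-first j = toℕ-fromℕ< (inner≥1 j)

  first-unique : ∀ {j} (s : Fin (inner j)) → toℕ s ≡ 0 → s ≡ first j
  first-unique {j} s s≡0 = toℕ-injective (trans s≡0 (sym (toℕ-first j)))

  onPath : (V n k → ℤ) → Fin n → ℕ → ℤ
  onPath f j = profile (inner j) (f ∘ internal j) (f vx) (f vy)

  laplacian-vx : ∀ f → laplacian f vx ≡ (f vx - f vy) + sum (λ j → f vx - onPath f j 1)
  laplacian-vx f =
    trans (laplacian-split f vx) (trans (ℤP.+-identityˡ _) (cong (_+_ (f vx - f vy))
      (sum-cong-≗ λ j → first-neighbour-sum (f ∘ internal j) (f vx) (f vy) (inner≥1 j))))

  laplacian-vy : ∀ f → laplacian f vy ≡ (f vy - f vx) + sum (λ j → f vy - onPath f j (inner j))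
  laplacian-vy f =
    trans (laplacian-split f vy) (cong (_+_ (f vy - f vx)) (trans (ℤP.+-identityˡ _)
      (sum-cong-≗ λ j → last-neighbour-sum (f ∘ internal j) (f vx) (f vy) (inner≥1 j))))

  laplacian-internal : ∀ f j s → laplacian f (internal j s) ≡ Δ² (onPath f j) (toℕ s)
  laplacian-internal f j s =
    trans (laplacian-split f (internal j s))
      (trans (cong (λ x → toward vx + (toward vy + x)) (trans (sum-single _ j off-path) on-path))
        (trans (inner-neighbour-sum (f ∘ internal j) (f vx) (f vy) s)
          (cong (λ x → (x - P (toℕ s)) + (x - P (suc (suc (toℕ s)))))
                (sym (profile-inner _ (f vx) (f vy) s)))))
    where
    P : ℕ → ℤ
    P = onPath f j
    toward : V n k → ℤ
    toward = towards f (internal j s)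
    off-path : ∀ j′ → j′ ≢ j → sum (toward ∘ internal j′) ≡ 0ℤ
    off-path j′ j′≢j rewrite ≢⇒≡ᶠ-false (j′≢j ∘ sym) | ≢⇒≡ᶠ-false j′≢j =
      sum-zero {inner j′} λ _ → refl
    on-path : sum (toward ∘ internal j) ≡ sum (λ s′ →
      if (suc (toℕ s) ≡ᵇ toℕ s′) ∨ (suc (toℕ s′) ≡ᵇ toℕ s) then f (internal j s) - f (internal j s′) else 0ℤ)
    on-path rewrite ≡ᵇ-refl (toℕ j) = refl

  -- Affine on path j, dropping by e j on its first edge, by c j on the middle ones and by z j on
  -- the last; closes says that every path ends at Y.
  module LinearFiring (X Y : ℤ) (e c z : Fin n → ℤ)
    (closes : ∀ j → Y ≡ X - e j - (+ inner j - 1ℤ) * c j - z j) where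

    firing : V n k → ℤ
    firing vx = X
    firing vy = Y
    firing (internal j s) = X - e j - + toℕ s * c j

    onPath-firing : ∀ j t → t < inner j → onPath firing j (suc t) ≡ X - e j - + t * c j
    onPath-firing j t t<m =
      trans (cong (onPath firing j ∘ suc) (sym (toℕ-fromℕ< t<m)))
        (trans (profile-inner _ X Y (fromℕ< t<m)) (cong (λ x → X - e j - + x * c j) (toℕ-fromℕ< t<m)))

    drop-in : ∀ j t → t < inner j → drop (onPath firing j) t ≡ (if t ≡ᵇ 0 then e j else c j)
    drop-in j zero 0<m = trans (cong (_-_ X) (onPath-firing j 0 0<m)) (lemma X (e j) (c j))
      where lemma : ∀ X e c → X - (X - e - 0ℤ * c) ≡ e
            lemma = solve-∀
    drop-in j (suc t) t<m =
      trans (cong₂ _-_ (onPath-firing j t (ℕP.<⇒≤ t<m)) (onPath-firing j (suc t) t<m))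
        (lemma X (e j) (c j) (+ t))
      where lemma : ∀ X e c T → (X - e - T * c) - (X - e - (1ℤ + T) * c) ≡ c
            lemma = solve-∀

    drop-last : ∀ j → drop (onPath firing j) (inner j) ≡ z j
    drop-last j = begin
        onPath firing j (inner j) - onPath firing j (suc (inner j))
      ≡⟨ cong₂ (λ m y → onPath firing j m - y) (sym m≡) (profile-last _ (firing ∘ internal j) X Y) ⟩
        onPath firing j (suc (inner j ∸ 1)) - Y
      ≡⟨ cong₂ _-_ (onPath-firing j (inner j ∸ 1) (subst (inner j ∸ 1 <_) m≡ (ℕP.n<1+n _)))
                   (closes j) ⟩
        (X - e j - m-1 * c j) - (X - e j - (+ inner j - 1ℤ) * c j - z j)
      ≡⟨ cong (λ m → (X - e j - m-1 * c j) - (X - e j - (+ m - 1ℤ) * c j - z j)) (sym m≡) ⟩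
        (X - e j - m-1 * c j) - (X - e j - ((1ℤ + m-1) - 1ℤ) * c j - z j)
      ≡⟨ lemma X (e j) (c j) (z j) m-1 ⟩
        z j ∎
      where
      open ≡-Reasoning
      m≡ : suc (inner j ∸ 1) ≡ inner j
      m≡ = suc-∸1 (inner≥1 j)
      m-1 : ℤ
      m-1 = + (inner j ∸ 1)
      lemma : ∀ X e c z T → (X - e - T * c) - (X - e - ((1ℤ + T) - 1ℤ) * c - z) ≡ z
      lemma = solve-∀

    drop-out : ∀ j t → t < inner j →
      drop (onPath firing j) (suc t) ≡ (if suc t ≡ᵇ inner j then z j else c j)
    drop-out j t t<m with ℕP.m≤n⇒m<n∨m≡n t<m
    ... | inj₁ 1+t<m rewrite <⇒≡ᵇ-false 1+t<m = drop-in j (suc t) 1+t<m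
    ... | inj₂ 1+t≡m rewrite 1+t≡m | ≡ᵇ-refl (inner j) = drop-last j

    laplacian-firing-vx : laplacian firing vx ≡ (X - Y) + sum e
    laplacian-firing-vx =
      trans (laplacian-vx firing) (cong (_+_ (X - Y)) (sum-cong-≗ λ j → drop-in j 0 (inner≥1 j)))

    laplacian-firing-vy : laplacian firing vy ≡ (Y - X) - sum z
    laplacian-firing-vy =
      trans (laplacian-vy firing) (cong (_+_ (Y - X)) (trans (sum-cong-≗ inward) (sum-neg z)))
      where
      inward : ∀ j → Y - onPath firing j (inner j) ≡ - z j
      inward j = trans (lemma Y (onPath firing j (inner j))) (cong -_ (trans
        (cong (_-_ (onPath firing j (inner j))) (sym (profile-last _ (firing ∘ internal j) X Y)))
        (drop-last j)))
        where lemma : ∀ y p → y - p ≡ - (p - y)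
              lemma = solve-∀

    laplacian-firing-internal : ∀ j s → laplacian firing (internal j s)
      ≡ (if suc (toℕ s) ≡ᵇ inner j then z j else c j) - (if toℕ s ≡ᵇ 0 then e j else c j)
    laplacian-firing-internal j s =
      trans (laplacian-internal firing j s) (trans (Δ²≡drop-difference (onPath firing j) (toℕ s))
        (cong₂ _-_ (drop-out j (toℕ s) (toℕ<n s)) (drop-in j (toℕ s) (toℕ<n s))))

  potential-drop : ∀ f j → (∀ (s : Fin (inner j)) → 1 ≤ toℕ s → laplacian f (internal j s) ≡ 0ℤ) →
    f vx - f vy ≡ + len j * (f vx - onPath f j 1) + + inner j * laplacian f (internal j (first j))
  potential-drop f j harmonic = begin
      f vx - f vy
    ≡⟨ cong (_-_ (f vx)) (sym (profile-last (inner j) (f ∘ internal j) (f vx) (f vy))) ⟩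
      P 0 - P (suc (inner j))
    ≡⟨ lemma₁ (P 0) (P 1) (P (suc (inner j))) ⟩
      drop P 0 + (P 1 - P (suc (inner j)))
    ≡⟨ cong (_+_ (drop P 0)) (harmonic⇒affine (P ∘ suc) (inner j) interior) ⟩
      drop P 0 + + inner j * drop P 1
    ≡⟨ cong (λ x → drop P 0 + + inner j * x) second-drop ⟩
      drop P 0 + + inner j * (drop P 0 + Δ)
    ≡⟨ lemma₂ (drop P 0) (+ inner j) Δ ⟩
      (1ℤ + + inner j) * drop P 0 + + inner j * Δ
    ≡⟨ cong (λ L → L * drop P 0 + + inner j * Δ) (sym (+len≡1++inner j)) ⟩
      + len j * drop P 0 + + inner j * Δ ∎
    where
    open ≡-Reasoning
    P : ℕ → ℤ
    P = onPath f j
    Δ : ℤ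
    Δ = laplacian f (internal j (first j))
    interior : ∀ t → suc t < inner j → Δ² (P ∘ suc) t ≡ 0ℤ
    interior t 1+t<m =
      trans (cong (Δ² P) (sym (toℕ-fromℕ< 1+t<m)))
        (trans (sym (laplacian-internal f j (fromℕ< 1+t<m)))
          (harmonic _ (subst (1 ≤_) (sym (toℕ-fromℕ< 1+t<m)) (s≤s z≤n))))
    lemma₃ : ∀ d₁ d₀ → d₁ ≡ d₀ + (d₁ - d₀)
    lemma₃ = solve-∀
    second-drop : drop P 1 ≡ drop P 0 + Δ
    second-drop = trans (lemma₃ (drop P 1) (drop P 0)) (cong (_+_ (drop P 0))
      (trans (sym (Δ²≡drop-difference P 0))
        (trans (cong (Δ² P) (sym (toℕ-first j))) (sym (laplacian-internal f j (first j))))))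
    lemma₁ : ∀ a b c → a - c ≡ (a - b) + (b - c)
    lemma₁ = solve-∀
    lemma₂ : ∀ d M Δ → d + M * (d + Δ) ≡ (1ℤ + M) * d + M * Δ
    lemma₂ = solve-∀

  potential-drop-harmonic : ∀ f j → (∀ s → laplacian f (internal j s) ≡ 0ℤ) →
    f vx - f vy ≡ + len j * (f vx - onPath f j 1)
  potential-drop-harmonic f j harmonic =
    trans (potential-drop f j λ s _ → harmonic s)
      (trans (cong (λ Δ → + len j * (f vx - onPath f j 1) + + inner j * Δ) (harmonic (first j)))
        (lemma (+ len j * (f vx - onPath f j 1)) (+ inner j)))
    where lemma : ∀ a b → a + b * 0ℤ ≡ a
          lemma = solve-∀

  outflow-vx : ∀ w {D : Divisor {n} {k}} f → (∀ v → (w · D) v - zeroDiv v ≡ laplacian f v) → D vx ≡ 1ℤ →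
    + w ≡ (f vx - f vy) + sum (λ j → f vx - onPath f j 1)
  outflow-vx w {D} f fires Dvx≡1 =
    trans (sym (trans (scaled-value w D vx) (trans (cong (_*_ (+ w)) Dvx≡1) (ℤP.*-identityʳ (+ w)))))
      (trans (fires vx) (laplacian-vx f))

  -- Annihilators of δ and ε

  -- d and c j stand for f vx − f vy and for the drop of a firing f on the first edge of path j.
  δFlow : ℤ → Set
  δFlow W = Σ ℤ λ d → Σ (Fin n → ℤ) λ c → (∀ j → d ≡ + len j * c j) × (W ≡ d + sum c)

  εFlow : Fin n → ℤ → Set
  εFlow i W = Σ ℤ λ d → Σ (Fin n → ℤ) λ c →
    (∀ j → j ≢ i → d ≡ + len j * c j) × (d ≡ + len i * c i - + inner i * W) × (W ≡ d + sum c)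

  ε : Fin n → Divisor {n} {k}
  ε i = unitDiff vx (internal i (first i))

  annihilated⇒δFlow : ∀ w → (w · δxy) ∼ zeroDiv → δFlow (+ w)
  annihilated⇒δFlow w (f , fires) = f vx - f vy , (λ j → f vx - onPath f j 1) , ohm , kirchhoff
    where
    harmonic : ∀ j s → laplacian f (internal j s) ≡ 0ℤ
    harmonic j s = trans (sym (fires (internal j s)))
      (trans (scaled-value w (δxy {n} {k}) (internal j s)) (ℤP.*-zeroʳ (+ w)))
    ohm : ∀ j → f vx - f vy ≡ + len j * (f vx - onPath f j 1)
    ohm j = potential-drop-harmonic f j (harmonic j)
    kirchhoff : + w ≡ (f vx - f vy) + sum (λ j → f vx - onPath f j 1)
    kirchhoff = outflow-vx w f fires refl

  scaled-ε-internal : ∀ w i j (s : Fin (inner j)) →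
    (w · ε i) (internal j s) - zeroDiv {n} {k} (internal j s)
      ≡ (if (j ≡ᶠ i) ∧ (toℕ s ≡ᵇ 0) then - + w else 0ℤ)
  scaled-ε-internal w i j s =
    trans (scaled-value w (ε i) (internal j s))
      (trans (cong (λ t → + w * (0ℤ - (if (j ≡ᶠ i) ∧ (toℕ s ≡ᵇ t) then 1ℤ else 0ℤ))) (toℕ-first i))
        (neg-indicator _ (+ w)))

  annihilated⇒εFlow : ∀ w i → (w · ε i) ∼ zeroDiv → εFlow i (+ w)
  annihilated⇒εFlow w i (f , fires) =
    f vx - f vy , (λ j → f vx - onPath f j 1) , ohm , ohm-i , outflow-vx w f fires refl
    where
    harmonic-off : ∀ j s → ((j ≡ᶠ i) ∧ (toℕ s ≡ᵇ 0)) ≡ false → laplacian f (internal j s) ≡ 0ℤ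
    harmonic-off j s off = trans (sym (fires (internal j s)))
      (trans (scaled-ε-internal w i j s) (cong (λ b → if b then - + w else 0ℤ) off))
    ohm : ∀ j → j ≢ i → f vx - f vy ≡ + len j * (f vx - onPath f j 1)
    ohm j j≢i = potential-drop-harmonic f j λ s →
      harmonic-off j s (cong (_∧ (toℕ s ≡ᵇ 0)) (≢⇒≡ᶠ-false j≢i))
    source : laplacian f (internal i (first i)) ≡ - + w
    source = trans (sym (fires (internal i (first i))))
      (trans (scaled-ε-internal w i i (first i))
        (cong (λ b → if b then - + w else 0ℤ) (cong₂ _∧_ (≡ᵇ-refl (toℕ i)) (cong (_≡ᵇ 0) (toℕ-first i)))))
    ohm-i : f vx - f vy ≡ + len i * (f vx - onPath f i 1) - + inner i * + w
    ohm-i = trans (potential-drop f i λ s 1≤s →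
              harmonic-off i s (trans (cong (_∧_ (i ≡ᶠ i)) (1≤⇒≡ᵇ0-false 1≤s)) (∧-zeroʳ _)))
      (trans (cong (λ Δ → + len i * (f vx - onPath f i 1) + + inner i * Δ) source)
        (lemma (+ len i * (f vx - onPath f i 1)) (+ inner i) (+ w)))
      where lemma : ∀ a b W → a + b * (- W) ≡ a - b * W
            lemma = solve-∀

  δFlow⇒annihilated : ∀ w → δFlow (+ w) → (w · δxy) ∼ zeroDiv
  δFlow⇒annihilated w (d , c , ohm , kirchhoff) = firing , fires
    where
    closes : ∀ j → 0ℤ ≡ d - c j - (+ inner j - 1ℤ) * c j - c j
    closes j = trans (lemma (c j) (+ inner j))
      (cong (λ x → x - c j - (+ inner j - 1ℤ) * c j - c j)
            (sym (trans (ohm j) (cong (_* c j) (+len≡1++inner j)))))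
      where lemma : ∀ c M → 0ℤ ≡ (1ℤ + M) * c - c - (M - 1ℤ) * c - c
            lemma = solve-∀
    open LinearFiring d 0ℤ c c c closes
    fires : ∀ v → (w · δxy) v - zeroDiv v ≡ laplacian firing v
    fires vx = trans (scaled-value w (δxy {n} {k}) vx) (trans (ℤP.*-identityʳ (+ w))
      (trans kirchhoff (trans (cong (_+ sum c) (sym (ℤP.+-identityʳ d))) (sym laplacian-firing-vx))))
    fires vy = trans (scaled-value w (δxy {n} {k}) vy) (trans (neg-indicator true (+ w))
      (trans (cong -_ kirchhoff) (trans (lemma d (sum c)) (sym laplacian-firing-vy))))
      where lemma : ∀ d S → - (d + S) ≡ (0ℤ - d) - S
            lemma = solve-∀
    fires (internal j s) = trans (scaled-value w (δxy {n} {k}) (internal j s)) (trans (ℤP.*-zeroʳ (+ w))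
      (sym (trans (laplacian-firing-internal j s)
        (trans (cong₂ _-_ (if-eta (suc (toℕ s) ≡ᵇ inner j)) (if-eta (toℕ s ≡ᵇ 0)))
          (ℤP.+-inverseʳ (c j))))))

  εFlow⇒annihilated : ∀ w i → εFlow i (+ w) → (w · ε i) ∼ zeroDiv
  εFlow⇒annihilated w i (d , e , ohm , ohm-i , kirchhoff) = firing , fires
    where
    c : Fin n → ℤ
    c j = if j ≡ᶠ i then e j - + w else e j
    closes-by : ∀ j b → (j ≡ᶠ i) ≡ b →
      0ℤ ≡ d - e j - (+ inner j - 1ℤ) * (if b then e j - + w else e j) - (if b then e j - + w else e j)
    closes-by j true j≡ᶠi with refl ← ≡ᶠ-true⇒≡ {i = j} {i} j≡ᶠi =
      trans (lemma (e i) (+ inner i) (+ w))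
        (cong (λ x → x - e i - (+ inner i - 1ℤ) * (e i - + w) - (e i - + w))
          (sym (trans ohm-i (cong (λ L → L * e i - + inner i * + w) (+len≡1++inner i)))))
      where lemma : ∀ e M w → 0ℤ ≡ ((1ℤ + M) * e - M * w) - e - (M - 1ℤ) * (e - w) - (e - w)
            lemma = solve-∀
    closes-by j false j≢ᶠi =
      trans (lemma (e j) (+ inner j))
        (cong (λ x → x - e j - (+ inner j - 1ℤ) * e j - e j)
              (sym (trans (ohm j (≡ᶠ-false⇒≢ j≢ᶠi)) (cong (_* e j) (+len≡1++inner j)))))
      where lemma : ∀ e M → 0ℤ ≡ (1ℤ + M) * e - e - (M - 1ℤ) * e - e
            lemma = solve-∀
    closes : ∀ j → 0ℤ ≡ d - e j - (+ inner j - 1ℤ) * c j - c j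
    closes j = closes-by j (j ≡ᶠ i) refl
    open LinearFiring d 0ℤ e c c closes
    jump : ∀ b₁ b₂ e W → (if b₁ then e - W else e) - (if b₂ then e else (if b₁ then e - W else e))
                         ≡ (if b₁ ∧ b₂ then - W else 0ℤ)
    jump true true e W = lemma e W
      where lemma : ∀ e W → (e - W) - e ≡ - W
            lemma = solve-∀
    jump true false e W = ℤP.+-inverseʳ (e - W)
    jump false true e W = ℤP.+-inverseʳ e
    jump false false e W = ℤP.+-inverseʳ e
    fires : ∀ v → (w · ε i) v - zeroDiv v ≡ laplacian firing v
    fires vx = trans (scaled-value w (ε i) vx) (trans (ℤP.*-identityʳ (+ w))
      (trans kirchhoff (trans (cong (_+ sum e) (sym (ℤP.+-identityʳ d))) (sym laplacian-firing-vx))))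
    fires vy = trans (scaled-value w (ε i) vy) (trans (ℤP.*-zeroʳ (+ w)) (sym (begin
        laplacian firing vy
      ≡⟨ laplacian-firing-vy ⟩
        (0ℤ - d) - sum c
      ≡⟨ cong (λ x → (0ℤ - d) - x) (sum-update e i (- + w)) ⟩
        (0ℤ - d) - (sum e - + w)
      ≡⟨ cong (λ W → (0ℤ - d) - (sum e - W)) kirchhoff ⟩
        (0ℤ - d) - (sum e - (d + sum e))
      ≡⟨ lemma d (sum e) ⟩
        0ℤ ∎)))
      where
      open ≡-Reasoning
      lemma : ∀ d S → (0ℤ - d) - (S - (d + S)) ≡ 0ℤ
      lemma = solve-∀
    fires (internal j s) = trans (scaled-ε-internal w i j s) (sym (trans (laplacian-firing-internal j s)
      (trans (cong (_- (if toℕ s ≡ᵇ 0 then e j else c j)) (if-eta (suc (toℕ s) ≡ᵇ inner j)))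
        (jump (j ≡ᶠ i) (toℕ s ≡ᵇ 0) (e j) (+ w)))))

  ε∼last : ∀ i (q : Fin (inner i)) → suc (toℕ q) ≡ inner i → ε i ∼ unitDiff (internal i q) vy
  ε∼last i q q-last = firing , values
    where
    -- The firing is −1 on the internal vertices of path i and 0 elsewhere.
    e z : Fin n → ℤ
    e j = if j ≡ᶠ i then 1ℤ else 0ℤ
    z j = if j ≡ᶠ i then -1ℤ else 0ℤ
    closes : ∀ j → 0ℤ ≡ 0ℤ - e j - (+ inner j - 1ℤ) * 0ℤ - z j
    closes j = closes-by (j ≡ᶠ i) (+ inner j)
      where
      closes-by : ∀ b M → 0ℤ ≡ 0ℤ - (if b then 1ℤ else 0ℤ) - (M - 1ℤ) * 0ℤ - (if b then -1ℤ else 0ℤ)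
      closes-by true = solve-∀
      closes-by false = solve-∀
    open LinearFiring 0ℤ 0ℤ e (λ _ → 0ℤ) z closes
    four-cases : ∀ A B → (0ℤ - (if A then 1ℤ else 0ℤ)) - ((if B then 1ℤ else 0ℤ) - 0ℤ)
                        ≡ (if B then -1ℤ else 0ℤ) - (if A then 1ℤ else 0ℤ)
    four-cases true true = refl
    four-cases true false = refl
    four-cases false true = refl
    four-cases false false = refl
    internal-values : ∀ j (s : Fin (inner j)) →
      (0ℤ - (if (j ≡ᶠ i) ∧ (toℕ s ≡ᵇ toℕ (first i)) then 1ℤ else 0ℤ))
        - ((if (j ≡ᶠ i) ∧ (toℕ s ≡ᵇ toℕ q) then 1ℤ else 0ℤ) - 0ℤ)
      ≡ (if suc (toℕ s) ≡ᵇ inner j then (if j ≡ᶠ i then -1ℤ else 0ℤ) else 0ℤ)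
        - (if toℕ s ≡ᵇ 0 then (if j ≡ᶠ i then 1ℤ else 0ℤ) else 0ℤ)
    internal-values j s with j ≡ᶠ i in j≡ᶠi
    ... | false = sym (cong₂ _-_ (if-eta (suc (toℕ s) ≡ᵇ inner j)) (if-eta (toℕ s ≡ᵇ 0)))
    ... | true with refl ← ≡ᶠ-true⇒≡ {i = j} {i} j≡ᶠi
      rewrite toℕ-first i | suc≡ᵇ-cong (toℕ s) q-last = four-cases (toℕ s ≡ᵇ 0) (toℕ s ≡ᵇ toℕ q)
    values : ∀ v → ε i v - unitDiff (internal i q) vy v ≡ laplacian firing v
    values vx = sym (trans laplacian-firing-vx (trans (ℤP.+-identityˡ _) (sum-indicator i 1ℤ)))
    values vy = sym (trans laplacian-firing-vy (trans (ℤP.+-identityˡ _) (cong -_ (sum-indicator i -1ℤ))))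
    values (internal j s) = trans (internal-values j s) (sym (laplacian-firing-internal j s))

  adjacent-annihilated : ∀ i (a b : V n k) →
    ((IsShared a × InternalOf i b) ⊎ (InternalOf i a × IsShared b)) →
    adj a b ≡ true → ∀ w → (w · unitDiff a b) ∼ zeroDiv ⇔ (w · ε i) ∼ zeroDiv
  adjacent-annihilated i _ _ (inj₁ (inj₁ refl , s , refl)) adj≡ w
    with refl ← first-unique s (≡ᵇ-true⇒≡ _ _ (trans (sym (∨-identityʳ _)) adj≡)) = mk⇔ id id
  adjacent-annihilated i _ _ (inj₂ ((s , refl) , inj₁ refl)) adj≡ w
    with refl ← first-unique s (≡ᵇ-true⇒≡ _ _ adj≡) =
    mk⇔ (annihilated-neg w (unitDiff-swap (internal i (first i)) vx))
        (annihilated-neg w (unitDiff-swap vx (internal i (first i))))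
  adjacent-annihilated i _ _ (inj₂ ((s , refl) , inj₂ refl)) adj≡ w =
    mk⇔ (annihilated-∼ w q∼ε) (annihilated-∼ w ε∼q)
    where
    ε∼q : ε i ∼ unitDiff (internal i s) vy
    ε∼q = ε∼last i s (≡ᵇ-true⇒≡ _ _ (trans (sym (∨-identityʳ _)) adj≡))
    q∼ε : unitDiff (internal i s) vy ∼ ε i
    q∼ε = ∼-sym {D = ε i} {D′ = unitDiff (internal i s) vy} ε∼q
  adjacent-annihilated i _ _ (inj₁ (inj₂ refl , s , refl)) adj≡ w =
    mk⇔ (annihilated-∼ w q∼ε ∘ annihilated-neg w (unitDiff-swap vy (internal i s)))
        (annihilated-neg w (unitDiff-swap (internal i s) vy) ∘ annihilated-∼ w ε∼q)
    where
    ε∼q : ε i ∼ unitDiff (internal i s) vy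
    ε∼q = ε∼last i s (≡ᵇ-true⇒≡ _ _ adj≡)
    q∼ε : unitDiff (internal i s) vy ∼ ε i
    q∼ε = ∼-sym {D = ε i} {D′ = unitDiff (internal i s) vy} ε∼q

  ℓ : ℕ
  ℓ = lcmᶠ len

  ℓ-nonZero : NonZero ℓ
  ℓ-nonZero = lcmᶠ-nonZero len λ j → subst NonZero (sym (len≡suc-inner j)) _

  cofactor : Fin n → ℕ
  cofactor j = _∣_.quotient (∣lcmᶠ len j)

  δ-order : ℕ
  δ-order = ℓ ℕ.+ ℕΣ.sum cofactor

  δFlow-δ-order : δFlow (+ δ-order)
  δFlow-δ-order =
    + ℓ , (λ j → + cofactor j) , ohm , trans (ℤP.pos-+ ℓ _) (cong (_+_ (+ ℓ)) (sym (sum-pos cofactor)))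
    where
    ohm : ∀ j → + ℓ ≡ + len j * + cofactor j
    ohm j = trans (cong +_ (_∣_.equality (∣lcmᶠ len j)))
      (trans (ℤP.pos-* (cofactor j) (len j)) (ℤP.*-comm (+ cofactor j) (+ len j)))

  -- ℓ W = d δ-order, and ℓ ∣ d since every len j divides d.
  δFlow⇒δ-order∣ : ∀ {W} → δFlow W → δ-order ∣ ∣ W ∣
  δFlow⇒δ-order∣ {W} (d , c , ohm , kirchhoff) =
    *-cancelˡ-∣ ℓ {{ℓ-nonZero}} (subst (λ x → ℓ ℕ.* δ-order ∣ x) ∣d∣δ-order≡ℓ∣W∣ (*-monoˡ-∣ δ-order ℓ∣d))
    where
    ℓ∣d : ℓ ∣ ∣ d ∣
    ℓ∣d = lcmᶠ-least len λ j →
      subst (len j ∣_) (sym (trans (cong ∣_∣ (ohm j)) (ℤP.abs-* (+ len j) (c j)))) (m∣m*n _)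
    scaled-current : ∀ j → + ℓ * c j ≡ + cofactor j * d
    scaled-current j = begin
        + ℓ * c j
      ≡⟨ cong (λ x → + x * c j) (_∣_.equality (∣lcmᶠ len j)) ⟩
        + (cofactor j ℕ.* len j) * c j
      ≡⟨ cong (_* c j) (ℤP.pos-* (cofactor j) (len j)) ⟩
        (+ cofactor j * + len j) * c j
      ≡⟨ ℤP.*-assoc (+ cofactor j) (+ len j) (c j) ⟩
        + cofactor j * (+ len j * c j)
      ≡⟨ cong (_*_ (+ cofactor j)) (sym (ohm j)) ⟩
        + cofactor j * d ∎
      where open ≡-Reasoning
    balance : + ℓ * W ≡ d * + δ-order
    balance = begin
        + ℓ * W
      ≡⟨ cong (_*_ (+ ℓ)) kirchhoff ⟩
        + ℓ * (d + sum c)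
      ≡⟨ ℤP.*-distribˡ-+ (+ ℓ) d (sum c) ⟩
        + ℓ * d + + ℓ * sum c
      ≡⟨ cong (_+_ (+ ℓ * d)) (trans (*-distribˡ-sum (+ ℓ) c) (sum-cong-≗ scaled-current)) ⟩
        + ℓ * d + sum (λ j → + cofactor j * d)
      ≡⟨ cong (_+_ (+ ℓ * d))
              (trans (sym (*-distribʳ-sum d (λ j → + cofactor j))) (cong (_* d) (sum-pos cofactor))) ⟩
        + ℓ * d + + ℕΣ.sum cofactor * d
      ≡⟨ lemma (+ ℓ) (+ ℕΣ.sum cofactor) d ⟩
        d * (+ ℓ + + ℕΣ.sum cofactor)
      ≡⟨ cong (_*_ d) (sym (ℤP.pos-+ ℓ _)) ⟩
        d * + δ-order ∎
      where
      open ≡-Reasoning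
      lemma : ∀ a b d → a * d + b * d ≡ d * (a + b)
      lemma = solve-∀
    ∣d∣δ-order≡ℓ∣W∣ : ∣ d ∣ ℕ.* δ-order ≡ ℓ ℕ.* ∣ W ∣
    ∣d∣δ-order≡ℓ∣W∣ =
      trans (sym (ℤP.abs-* d (+ δ-order))) (trans (cong ∣_∣ (sym balance)) (ℤP.abs-* (+ ℓ) W))

  -- len i ∣ len j₀ ∣ d, so the equation of path i makes len i divide W.
  εFlow⇒δFlow : ∀ {i j₀} → j₀ ≢ i → len i ∣ len j₀ →
    ∀ {W} → εFlow i W → Σ ℤ λ W′ → (W ≡ + len i * W′) × δFlow W′
  εFlow⇒δFlow {i} {j₀} j₀≢i (divides q len≡) {W} (d , e , ohm , ohm-i , kirchhoff) =
    W′ , W≡ , d , c , (λ j → ohm-by j (j ≡ᶠ i) refl) , kirchhoff′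
    where
    M L : ℤ
    M = + inner i
    L = 1ℤ + M
    ohm-i′ : d ≡ L * e i - M * W
    ohm-i′ = trans ohm-i (cong (λ x → x * e i - M * W) (+len≡1++inner i))
    d≡ : d ≡ L * (+ q * e j₀)
    d≡ = begin
        d
      ≡⟨ ohm j₀ j₀≢i ⟩
        + len j₀ * e j₀
      ≡⟨ cong (λ x → + x * e j₀) len≡ ⟩
        + (q ℕ.* len i) * e j₀
      ≡⟨ cong (_* e j₀) (trans (ℤP.pos-* q (len i)) (cong (_*_ (+ q)) (+len≡1++inner i))) ⟩
        (+ q * L) * e j₀
      ≡⟨ lemma (+ q) L (e j₀) ⟩
        L * (+ q * e j₀) ∎
      where
      open ≡-Reasoning
      lemma : ∀ a b c → (a * b) * c ≡ b * (a * c)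
      lemma = solve-∀
    W′ : ℤ
    W′ = + q * e j₀ - e i + W
    W≡′ : W ≡ L * W′
    W≡′ = begin
        W
      ≡⟨ lemma₁ W (e i) M ⟩
        (L * e i - M * W) - L * e i + L * W
      ≡⟨ cong (λ x → x - L * e i + L * W) (trans (sym ohm-i′) d≡) ⟩
        L * (+ q * e j₀) - L * e i + L * W
      ≡⟨ lemma₂ L (+ q * e j₀) (e i) W ⟩
        L * W′ ∎
      where
      open ≡-Reasoning
      lemma₁ : ∀ W e M → W ≡ ((1ℤ + M) * e - M * W) - (1ℤ + M) * e + (1ℤ + M) * W
      lemma₁ = solve-∀
      lemma₂ : ∀ L D e W → L * D - L * e + L * W ≡ L * (D - e + W)
      lemma₂ = solve-∀
    W≡ : W ≡ + len i * W′
    W≡ = trans W≡′ (cong (_* W′) (sym (+len≡1++inner i)))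
    c : Fin n → ℤ
    c j = if j ≡ᶠ i then e j - M * W′ else e j
    ohm-by : ∀ j b → (j ≡ᶠ i) ≡ b → d ≡ + len j * (if b then e j - M * W′ else e j)
    ohm-by j false j≢ᶠi = ohm j (≡ᶠ-false⇒≢ j≢ᶠi)
    ohm-by j true j≡ᶠi with refl ← ≡ᶠ-true⇒≡ {i = j} {i} j≡ᶠi =
      trans ohm-i′ (trans (cong (λ x → L * e i - M * x) W≡′)
        (trans (lemma L M (e i) W′) (cong (_* (e i - M * W′)) (sym (+len≡1++inner i)))))
      where lemma : ∀ L M e W → L * e - M * (L * W) ≡ L * (e - M * W)
            lemma = solve-∀
    kirchhoff′ : W′ ≡ d + sum c
    kirchhoff′ = begin
        W′
      ≡⟨ lemma₁ W′ M ⟩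
        L * W′ - M * W′
      ≡⟨ cong (_- M * W′) (trans (sym W≡′) kirchhoff) ⟩
        (d + sum e) - M * W′
      ≡⟨ ℤP.+-assoc d (sum e) _ ⟩
        d + (sum e - M * W′)
      ≡⟨ cong (_+_ d) (sym (sum-update e i (- (M * W′)))) ⟩
        d + sum c ∎
      where
      open ≡-Reasoning
      lemma₁ : ∀ W M → W ≡ (1ℤ + M) * W - M * W
      lemma₁ = solve-∀

  δFlow⇒εFlow : ∀ i {W′} → δFlow W′ → εFlow i (+ len i * W′)
  δFlow⇒εFlow i {W′} (d , c , ohm , kirchhoff) = d , e , ohm′ , ohm-i , kirchhoff′
    where
    M : ℤ
    M = + inner i
    e : Fin n → ℤ
    e j = if j ≡ᶠ i then c j + M * W′ else c j
    ohm′ : ∀ j → j ≢ i → d ≡ + len j * e j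
    ohm′ j j≢i rewrite ≢⇒≡ᶠ-false j≢i = ohm j
    ohm-i : d ≡ + len i * e i - M * (+ len i * W′)
    ohm-i rewrite ≡ᵇ-refl (toℕ i) = trans (ohm i) (lemma (+ len i) M (c i) W′)
      where lemma : ∀ L M c W → L * c ≡ L * (c + M * W) - M * (L * W)
            lemma = solve-∀
    kirchhoff′ : + len i * W′ ≡ d + sum e
    kirchhoff′ = begin
        + len i * W′
      ≡⟨ cong (_* W′) (+len≡1++inner i) ⟩
        (1ℤ + M) * W′
      ≡⟨ lemma W′ M ⟩
        W′ + M * W′
      ≡⟨ cong (_+ M * W′) kirchhoff ⟩
        (d + sum c) + M * W′
      ≡⟨ ℤP.+-assoc d (sum c) _ ⟩
        d + (sum c + M * W′)
      ≡⟨ cong (_+_ d) (sym (sum-update c i (M * W′))) ⟩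
        d + sum e ∎
      where
      open ≡-Reasoning
      lemma : ∀ W M → (1ℤ + M) * W ≡ W + M * W
      lemma = solve-∀

  0<δ-order : 0 < δ-order
  0<δ-order = ℕP.<-≤-trans (ℕ.>-nonZero⁻¹ ℓ {{ℓ-nonZero}}) (ℕP.m≤m+n ℓ (ℕΣ.sum cofactor))

  0<ε-order : ∀ i → 0 < len i ℕ.* δ-order
  0<ε-order i =
    subst (λ L → 0 < L ℕ.* δ-order) (sym (len≡suc-inner i)) (ℕP.m<n⇒m<o*n (suc (inner i)) 0<δ-order)

  δ-annihilator : ∀ w → (w · δxy) ∼ zeroDiv → δ-order ∣ w
  δ-annihilator w = δFlow⇒δ-order∣ ∘ annihilated⇒δFlow w

  δ-order-annihilates : (δ-order · δxy) ∼ zeroDiv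
  δ-order-annihilates = δFlow⇒annihilated δ-order δFlow-δ-order

  ε-annihilator : ∀ {i j₀} → j₀ ≢ i → len i ∣ len j₀ →
    ∀ w → (w · ε i) ∼ zeroDiv → len i ℕ.* δ-order ∣ w
  ε-annihilator {i} j₀≢i len∣ w wε∼0 =
    divides-w (εFlow⇒δFlow j₀≢i len∣ (annihilated⇒εFlow w i wε∼0))
    where
    divides-w : (Σ ℤ λ W′ → (+ w ≡ + len i * W′) × δFlow W′) → len i ℕ.* δ-order ∣ w
    divides-w (W′ , w≡ , flow) =
      subst (λ x → len i ℕ.* δ-order ∣ x) w≡′ (*-monoʳ-∣ (len i) (δFlow⇒δ-order∣ flow))
      where
      w≡′ : len i ℕ.* ∣ W′ ∣ ≡ w
      w≡′ = sym (trans (cong ∣_∣ w≡) (ℤP.abs-* (+ len i) W′))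

  ε-order-annihilates : ∀ i → ((len i ℕ.* δ-order) · ε i) ∼ zeroDiv
  ε-order-annihilates i =
    εFlow⇒annihilated (len i ℕ.* δ-order) i
      (subst (εFlow i) (sym (ℤP.pos-* (len i) δ-order)) (δFlow⇒εFlow i δFlow-δ-order))

open import Data.Nat using (_+_; _*_)

length-multiple : ∀ {n} (k : Fin n → ℕ) i
  → ((Σ (Fin n) λ j → (j ≢ i) × (k j ≡ k i))
     ⊎ (Σ (Fin n) λ j → (j ≢ i) × (Σ ℕ λ t → (1 ≤ t) × (k j ≡ t * (k i ∸ 1) + 1))))
  → Σ (Fin n) λ j → (j ≢ i) × (k i ∸ 1 ∣ k j ∸ 1)
length-multiple k i (inj₁ (j , j≢i , kj≡ki)) = j , j≢i , ∣-reflexive (cong (_∸ 1) (sym kj≡ki))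
length-multiple k i (inj₂ (j , j≢i , t , _ , kj≡)) =
  j , j≢i , divides t (trans (cong (_∸ 1) kj≡) (ℕP.m+n∸n≡m (t * (k i ∸ 1)) 1))

theorem4p4 : (n : ℕ) (k : Fin n → ℕ) → 2 ≤ n → (∀ j → 3 ≤ k j) → (i : Fin n)
    → ((Σ (Fin n) λ j → (j ≢ i) × (k j ≡ k i))
       ⊎ (Σ (Fin n) λ j → (j ≢ i) × (Σ ℕ λ t → (1 ≤ t) × (k j ≡ t * (k i ∸ 1) + 1))))
    → (a b : V n k)
    → ((IsShared a × InternalOf i b) ⊎ (InternalOf i a × IsShared b))
    → adj a b ≡ true
    → Σ ℕ λ m → IsOrder (δxy {n} {k}) m × IsOrder (unitDiff a b) ((k i ∸ 1) * m)
theorem4p4 n k _ k≥3 i multiple a b position adjacent =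
  δ-order ,
  IsOrder-from-annihilator δ-order 0<δ-order δ-order-annihilates δ-annihilator ,
  IsOrder-from-annihilator (len i * δ-order) (0<ε-order i)
    (Equivalence.from (ε-equivalent (len i * δ-order)) (ε-order-annihilates i))
    (λ w → ε-annihilator j₀≢i len∣len-j₀ w ∘ Equivalence.to (ε-equivalent w))
  where
  open Hinge {n} {k} (λ j → 3≤⇒1≤∸2 (k≥3 j))
  witness : Σ (Fin n) λ j → (j ≢ i) × (len i ∣ len j)
  witness = length-multiple k i multiple
  j₀≢i : proj₁ witness ≢ i
  j₀≢i = proj₁ (proj₂ witness)
  len∣len-j₀ : len i ∣ len (proj₁ witness)
  len∣len-j₀ = proj₂ (proj₂ witness)
  ε-equivalent : ∀ w → (w · unitDiff a b) ∼ zeroDiv ⇔ (w · ε i) ∼ zeroDiv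
  ε-equivalent = adjacent-annihilated i a b position adjacent
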